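{- Let $(Z_1,E_1)$ and $(Z_2,E_2)$ be convex geometries with $Z_1\cap Z_2=\emptyset$. (a) If both are (isomorphic to) poset shelling convex geometries, then so is their product $(Z_1\cup Z_2,E_{Z_1Z_2})$. (b) If both are (isomorphic to) digraph point search convex geometries, then so is their product $(Z_1\cup Z_2,E_{Z_1Z_2})$.
   Context: A convex geometry is a pair $(Z,E)$ with $Z$ a finite nonempty set and $E\subseteq 2^Z$ satisfying: (i) $\emptyset\in E$, $Z\in E$; (ii) $X,Y\in E\Rightarrow X\cap Y\in E$; (iii) for every $X\in E\setminus\{Z\}$ there is $z\in Z\setminus X$ with $X\cup\{z\}\in E$. Two convex geometries are isomorphic if their lattices of closed sets (ordered by inclusion) are isomorphic. For disjoint $Z_1,Z_2$, the product is $(Z_1\cup Z_2,E_{Z_1Z_2})$ with $E_{Z_1Z_2}=\{X_1\cup X_2: X_1\in E_1,X_2\in E_2\}$. A poset shelling convex geometry is one of the form $(P,E)$ where $(P,\le)$ is a finite poset and $E$ is the set of down-sets of $P$ (sets $X$ with $e\in X$, $f\le e\Rightarrow f\in X$). A digraph point search convex geometry is one of the form $(V,E)$ where $G$ is a finite directed graph on vertex set $V\cup\{r\}$ with a distinguished root $r\notin V$, and $E$ consists of the complements $V\setminus A$ of the sets $A\subseteq V$ such that every vertex $x\in A$ is reachable from $r$ by a directed path all of whose vertices other than $r$ lie in $A$. -}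

module Defs where

open import Data.Nat using (ℕ; suc; _+_; _≤_)
open import Data.Fin using (Fin; zero; suc)
open import Data.Fin.Subset using (Subset; _∈_; _∉_; _⊆_; _∩_; _∪_; ∁; ⁅_⁆)
  renaming (⊥ to ∅; ⊤ to full)
open import Data.Vec using (_++_)
open import Data.Product using (Σ; ∃; ∃-syntax; _×_)
open import Relation.Binary.PropositionalEquality using (_≡_; _≢_)
open import Relation.Binary.Structures using (IsPartialOrder)

-- A family of subsets of the finite ground set Fin n (Z is modelled as Fin n).
Family : ℕ → Set₁
Family n = Subset n → Set

record IsConvexGeometry (n : ℕ) (E : Family n) : Set where
  field
    nonempty  : 1 ≤ n
    empty∈    : E ∅
    full∈     : E full
    ∩-closed  : ∀ X Y → E X → E Y → E (X ∩ Y)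
    extension : ∀ X → E X → X ≢ full → ∃[ z ] (z ∉ X × E (X ∪ ⁅ z ⁆))

-- Isomorphism of convex geometries: order isomorphism (w.r.t. inclusion)
-- between their lattices of closed sets.
record _≅_ {n m : ℕ} (E : Family n) (F : Family m) : Set where
  field
    to       : Subset n → Subset m
    from     : Subset m → Subset n
    to-cl    : ∀ X → E X → F (to X)
    from-cl  : ∀ Y → F Y → E (from Y)
    from-to  : ∀ X → E X → from (to X) ≡ X
    to-from  : ∀ Y → F Y → to (from Y) ≡ Y
    to-mono  : ∀ X X′ → E X → E X′ → X ⊆ X′ → to X ⊆ to X′
    to-refl  : ∀ X X′ → E X → E X′ → to X ⊆ to X′ → X ⊆ X′

-- Product of geometries on disjoint ground sets Fin n₁ and Fin n₂;
-- the disjoint union is Fin (n₁ + n₂), with Fin n₁ the first block.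
product : {n₁ n₂ : ℕ} → Family n₁ → Family n₂ → Family (n₁ + n₂)
product E₁ E₂ Y = ∃[ X₁ ] ∃[ X₂ ] (E₁ X₁ × E₂ X₂ × Y ≡ X₁ ++ X₂)

downSets : {k : ℕ} → (Fin k → Fin k → Set) → Family k
downSets _≼_ X = ∀ e f → e ∈ X → f ≼ e → f ∈ X

IsPosetShelling : (n : ℕ) → Family n → Set₁
IsPosetShelling n E =
  ∃[ k ] Σ (Fin k → Fin k → Set) λ _≼_ →
    IsPartialOrder _≡_ _≼_ × (E ≅ downSets _≼_)

-- Digraph point search: digraph on Fin (suc m) = V ∪ {r}, root r = zero,
-- V = Fin m embedded via suc.
module _ {m : ℕ} (Adj : Fin (suc m) → Fin (suc m) → Set) (A : Subset m) where
  data ReachIn : Fin m → Set where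
    start : ∀ {x} → x ∈ A → Adj zero (suc x) → ReachIn x
    step  : ∀ {x y} → ReachIn x → y ∈ A → Adj (suc x) (suc y) → ReachIn y

pointSearch : {m : ℕ} → (Fin (suc m) → Fin (suc m) → Set) → Family m
pointSearch Adj X =
  ∃[ A ] ((∀ x → x ∈ A → ReachIn Adj A x) × X ≡ ∁ A)

IsDigraphPointSearch : (n : ℕ) → Family n → Set₁
IsDigraphPointSearch n E =
  ∃[ m ] Σ (Fin (suc m) → Fin (suc m) → Set) λ Adj → E ≅ pointSearch Adj

-- The closed sets of a product are the unions X₁ ∪ X₂ of closed sets of the
-- factors, and the product respects isomorphism, so it suffices to realise the
-- product of two model geometries as a model geometry of the same kind. The
-- down-sets of the disjoint sum of two posets are exactly the unions of
-- down-sets of the summands. Gluing two rooted digraphs at their roots gives a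
-- digraph in which every search path stays inside one of the two sides, so a
-- set is searchable there iff both of its halves are searchable.
module Submission where

open import Defs
open import Level using (Level)
open import Data.Nat using (ℕ; _+_; suc)
open import Data.Product using (_×_; _,_)
open import Data.Sum using (inj₁; inj₂; [_,_]′)
open import Data.Sum.Relation.Binary.Pointwise
  using (Pointwise; inj₁; inj₂; ⊎-isPartialOrder; Pointwise-≡⇒≡)
open import Data.Empty using (⊥-elim)
open import Data.Fin using (Fin; zero; suc; _↑ˡ_; _↑ʳ_; splitAt; join)
open import Data.Fin.Properties
  using (suc-injective; ↑ˡ-injective; ↑ʳ-injective; splitAt-↑ˡ; splitAt-↑ʳ;
         splitAt⁻¹-↑ˡ; splitAt⁻¹-↑ʳ; join-splitAt)
open import Data.Fin.Subset using (Subset; _∈_; _⊆_; ∁)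
open import Data.Fin.Subset.Properties using (drop-∷-⊆)
open import Data.Vec using (Vec; []; _∷_; _++_; take; drop; here; there)
import Data.Vec as Vec
open import Data.Vec.Properties
  using (take++drop≡id; ++-injectiveˡ; ++-injectiveʳ; map-++)
open import Function.Base using (id; _∘_; _on_)
open import Relation.Binary.Core using (Rel)
open import Relation.Binary.Structures using (IsPartialOrder)
open import Relation.Binary.PropositionalEquality
open import Relation.Unary using (_≐_)

private
  variable
    a b ℓ₁ ℓ₂ : Level
    A B : Set a
    n₁ n₂ m₁ m₂ k₁ k₂ : ℕ

take-++ : (xs : Vec A n₁) (ys : Vec A n₂) → take n₁ (xs ++ ys) ≡ xs
take-++ {n₁ = n₁} xs ys = ++-injectiveˡ _ xs (take++drop≡id n₁ (xs ++ ys))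

drop-++ : (xs : Vec A n₁) (ys : Vec A n₂) → drop n₁ (xs ++ ys) ≡ ys
drop-++ {n₁ = n₁} xs ys = ++-injectiveʳ (take n₁ (xs ++ ys)) xs (take++drop≡id n₁ (xs ++ ys))

↑ˡ≢↑ʳ : (i : Fin n₁) (j : Fin n₂) → i ↑ˡ n₂ ≢ n₁ ↑ʳ j
↑ˡ≢↑ʳ zero    j ()
↑ˡ≢↑ʳ (suc i) j eq = ↑ˡ≢↑ʳ i j (suc-injective eq)

splitAt-injective : ∀ m {n} {x y : Fin (m + n)} → splitAt m x ≡ splitAt m y → x ≡ y
splitAt-injective m {n} {x} {y} eq = begin
  x                      ≡⟨ join-splitAt m n x ⟨
  join m n (splitAt m x) ≡⟨ cong (join m n) eq ⟩
  join m n (splitAt m y) ≡⟨ join-splitAt m n y ⟩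
  y                      ∎
  where open ≡-Reasoning

∈-++⁺ˡ : {X₁ : Subset n₁} {X₂ : Subset n₂} {i : Fin n₁} → i ∈ X₁ → i ↑ˡ n₂ ∈ X₁ ++ X₂
∈-++⁺ˡ here      = here
∈-++⁺ˡ (there p) = there (∈-++⁺ˡ p)

∈-++⁻ˡ : (X₁ : Subset n₁) {X₂ : Subset n₂} {i : Fin n₁} → i ↑ˡ n₂ ∈ X₁ ++ X₂ → i ∈ X₁
∈-++⁻ˡ (_ ∷ _)  {i = zero}  here      = here
∈-++⁻ˡ (_ ∷ X₁) {i = suc i} (there p) = there (∈-++⁻ˡ X₁ p)

∈-++⁺ʳ : (X₁ : Subset n₁) {X₂ : Subset n₂} {j : Fin n₂} → j ∈ X₂ → n₁ ↑ʳ j ∈ X₁ ++ X₂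
∈-++⁺ʳ []       p = p
∈-++⁺ʳ (_ ∷ X₁) p = there (∈-++⁺ʳ X₁ p)

∈-++⁻ʳ : (X₁ : Subset n₁) {X₂ : Subset n₂} {j : Fin n₂} → n₁ ↑ʳ j ∈ X₁ ++ X₂ → j ∈ X₂
∈-++⁻ʳ []       p         = p
∈-++⁻ʳ (_ ∷ X₁) (there p) = ∈-++⁻ʳ X₁ p

∈-++⁻ : (X₁ : Subset n₁) {X₂ : Subset n₂} {x : Fin (n₁ + n₂)} →
        x ∈ X₁ ++ X₂ → [ _∈ X₁ , _∈ X₂ ]′ (splitAt n₁ x)
∈-++⁻ {n₁} X₁ {X₂} {x} p with splitAt n₁ x in eq
... | inj₁ i = ∈-++⁻ˡ X₁ (subst (_∈ X₁ ++ X₂) (sym (splitAt⁻¹-↑ˡ eq)) p)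
... | inj₂ j = ∈-++⁻ʳ X₁ (subst (_∈ X₁ ++ X₂) (sym (splitAt⁻¹-↑ʳ eq)) p)

∈-++⁺ : (X₁ : Subset n₁) {X₂ : Subset n₂} {x : Fin (n₁ + n₂)} →
        [ _∈ X₁ , _∈ X₂ ]′ (splitAt n₁ x) → x ∈ X₁ ++ X₂
∈-++⁺ {n₁} X₁ {X₂} {x} p with splitAt n₁ x in eq
... | inj₁ i = subst (_∈ X₁ ++ X₂) (splitAt⁻¹-↑ˡ eq) (∈-++⁺ˡ p)
... | inj₂ j = subst (_∈ X₁ ++ X₂) (splitAt⁻¹-↑ʳ eq) (∈-++⁺ʳ X₁ p)

++-⊆⁺ : {X₁ Y₁ : Subset n₁} {X₂ Y₂ : Subset n₂} → X₁ ⊆ Y₁ → X₂ ⊆ Y₂ → X₁ ++ X₂ ⊆ Y₁ ++ Y₂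
++-⊆⁺ {X₁ = []}    {[]}    _  X₂⊆Y₂ p = X₂⊆Y₂ p
++-⊆⁺ {X₁ = _ ∷ _} {_ ∷ _} X₁⊆Y₁ _ here with X₁⊆Y₁ here
... | here = here
++-⊆⁺ {X₁ = _ ∷ _} {_ ∷ _} X₁⊆Y₁ X₂⊆Y₂ (there p) = there (++-⊆⁺ (drop-∷-⊆ X₁⊆Y₁) X₂⊆Y₂ p)

++-⊆⁻ : (X₁ Y₁ : Subset n₁) {X₂ Y₂ : Subset n₂} → X₁ ++ X₂ ⊆ Y₁ ++ Y₂ → X₁ ⊆ Y₁ × X₂ ⊆ Y₂
++-⊆⁻ X₁ Y₁ X⊆Y = (∈-++⁻ˡ Y₁ ∘ X⊆Y ∘ ∈-++⁺ˡ) , (∈-++⁻ʳ Y₁ ∘ X⊆Y ∘ ∈-++⁺ʳ X₁)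

∁-++ : (X₁ : Subset n₁) (X₂ : Subset n₂) → ∁ (X₁ ++ X₂) ≡ ∁ X₁ ++ ∁ X₂
∁-++ = map-++ _

≐⇒≅ : {E F : Family n₁} → E ≐ F → E ≅ F
≐⇒≅ (E⊆F , F⊆E) = record
  { to      = id
  ; from    = id
  ; to-cl   = λ _ → E⊆F
  ; from-cl = λ _ → F⊆E
  ; from-to = λ _ _ → refl
  ; to-from = λ _ _ → refl
  ; to-mono = λ _ _ _ _ → id
  ; to-refl = λ _ _ _ _ → id
  }

≅-trans : {E : Family n₁} {F : Family n₂} {G : Family m₁} → E ≅ F → F ≅ G → E ≅ G
≅-trans I J = record
  { to      = J.to ∘ I.to
  ; from    = I.from ∘ J.from
  ; to-cl   = λ X e → J.to-cl _ (I.to-cl X e)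
  ; from-cl = λ Z g → I.from-cl _ (J.from-cl Z g)
  ; from-to = λ X e → trans (cong I.from (J.from-to _ (I.to-cl X e))) (I.from-to X e)
  ; to-from = λ Z g → trans (cong J.to (I.to-from _ (J.from-cl Z g))) (J.to-from Z g)
  ; to-mono = λ X X′ e e′ → J.to-mono _ _ (I.to-cl X e) (I.to-cl X′ e′) ∘ I.to-mono X X′ e e′
  ; to-refl = λ X X′ e e′ → I.to-refl X X′ e e′ ∘ J.to-refl _ _ (I.to-cl X e) (I.to-cl X′ e′)
  }
  where
  module I = _≅_ I
  module J = _≅_ J

splitMap : (Subset n₁ → Subset m₁) → (Subset n₂ → Subset m₂) →
           Subset (n₁ + n₂) → Subset (m₁ + m₂)
splitMap {n₁} f₁ f₂ Y = f₁ (take n₁ Y) ++ f₂ (drop n₁ Y)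

splitMap-++ : (f₁ : Subset n₁ → Subset m₁) (f₂ : Subset n₂ → Subset m₂)
              (X₁ : Subset n₁) (X₂ : Subset n₂) →
              splitMap f₁ f₂ (X₁ ++ X₂) ≡ f₁ X₁ ++ f₂ X₂
splitMap-++ f₁ f₂ X₁ X₂ = cong₂ _++_ (cong f₁ (take-++ X₁ X₂)) (cong f₂ (drop-++ X₁ X₂))

product-cong : {E₁ : Family n₁} {F₁ : Family m₁} {E₂ : Family n₂} {F₂ : Family m₂} →
               E₁ ≅ F₁ → E₂ ≅ F₂ → product E₁ E₂ ≅ product F₁ F₂
product-cong I J = record
  { to      = splitMap I.to J.to
  ; from    = splitMap I.from J.from
  ; to-cl   = λ { _ (X₁ , X₂ , e₁ , e₂ , refl) →
      I.to X₁ , J.to X₂ , I.to-cl X₁ e₁ , J.to-cl X₂ e₂ , splitMap-++ I.to J.to X₁ X₂ }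
  ; from-cl = λ { _ (Z₁ , Z₂ , f₁ , f₂ , refl) →
      I.from Z₁ , J.from Z₂ , I.from-cl Z₁ f₁ , J.from-cl Z₂ f₂ , splitMap-++ I.from J.from Z₁ Z₂ }
  ; from-to = λ { _ (X₁ , X₂ , e₁ , e₂ , refl) →
      splitMap-inverse I.to J.to I.from J.from (I.from-to X₁ e₁) (J.from-to X₂ e₂) }
  ; to-from = λ { _ (Z₁ , Z₂ , f₁ , f₂ , refl) →
      splitMap-inverse I.from J.from I.to J.to (I.to-from Z₁ f₁) (J.to-from Z₂ f₂) }
  ; to-mono = λ { _ _ (X₁ , X₂ , e₁ , e₂ , refl) (X₁′ , X₂′ , e₁′ , e₂′ , refl) X⊆X′ →
      let X₁⊆X₁′ , X₂⊆X₂′ = ++-⊆⁻ X₁ X₁′ X⊆X′ in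
      subst₂ _⊆_ (sym (splitMap-++ I.to J.to X₁ X₂)) (sym (splitMap-++ I.to J.to X₁′ X₂′))
        (++-⊆⁺ (I.to-mono X₁ X₁′ e₁ e₁′ X₁⊆X₁′) (J.to-mono X₂ X₂′ e₂ e₂′ X₂⊆X₂′)) }
  ; to-refl = λ { _ _ (X₁ , X₂ , e₁ , e₂ , refl) (X₁′ , X₂′ , e₁′ , e₂′ , refl) toX⊆toX′ →
      let Z₁⊆Z₁′ , Z₂⊆Z₂′ = ++-⊆⁻ (I.to X₁) (I.to X₁′)
            (subst₂ _⊆_ (splitMap-++ I.to J.to X₁ X₂) (splitMap-++ I.to J.to X₁′ X₂′) toX⊆toX′) in
      ++-⊆⁺ (I.to-refl X₁ X₁′ e₁ e₁′ Z₁⊆Z₁′) (J.to-refl X₂ X₂′ e₂ e₂′ Z₂⊆Z₂′) }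
  }
  where
  module I = _≅_ I
  module J = _≅_ J

  splitMap-inverse : ∀ {p₁ q₁ p₂ q₂} (f₁ : Subset p₁ → Subset q₁) (f₂ : Subset p₂ → Subset q₂) g₁ g₂
                       {X₁ : Subset p₁} {X₂ : Subset p₂} →
                     g₁ (f₁ X₁) ≡ X₁ → g₂ (f₂ X₂) ≡ X₂ →
                     splitMap g₁ g₂ (splitMap f₁ f₂ (X₁ ++ X₂)) ≡ X₁ ++ X₂
  splitMap-inverse f₁ f₂ g₁ g₂ {X₁} {X₂} g₁f₁ g₂f₂ = begin
    splitMap g₁ g₂ (splitMap f₁ f₂ (X₁ ++ X₂)) ≡⟨ cong (splitMap g₁ g₂) (splitMap-++ f₁ f₂ X₁ X₂) ⟩
    splitMap g₁ g₂ (f₁ X₁ ++ f₂ X₂)             ≡⟨ splitMap-++ g₁ g₂ (f₁ X₁) (f₂ X₂) ⟩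
    g₁ (f₁ X₁) ++ g₂ (f₂ X₂)                   ≡⟨ cong₂ _++_ g₁f₁ g₂f₂ ⟩
    X₁ ++ X₂                                   ∎
    where open ≡-Reasoning

isPartialOrder-on : {_≈_ : Rel B ℓ₁} {_≤_ : Rel B ℓ₂} (f : A → B) →
                    (∀ {x y} → f x ≈ f y → x ≡ y) →
                    IsPartialOrder _≈_ _≤_ → IsPartialOrder _≡_ (_≤_ on f)
isPartialOrder-on f f-injective po = record
  { isPreorder = record
    { isEquivalence = isEquivalence
    ; reflexive     = λ { refl → P.refl }
    ; trans         = P.trans
    }
  ; antisym    = λ x≤y y≤x → f-injective (P.antisym x≤y y≤x)
  }
  where module P = IsPartialOrder po

_⊕_ : (Fin k₁ → Fin k₁ → Set) → (Fin k₂ → Fin k₂ → Set) → Fin (k₁ + k₂) → Fin (k₁ + k₂) → Set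
_⊕_ {k₁} R₁ R₂ = Pointwise R₁ R₂ on splitAt k₁

module _ {R₁ : Fin k₁ → Fin k₁ → Set} {R₂ : Fin k₂ → Fin k₂ → Set} where

  ⊕-isPartialOrder : IsPartialOrder _≡_ R₁ → IsPartialOrder _≡_ R₂ → IsPartialOrder _≡_ (R₁ ⊕ R₂)
  ⊕-isPartialOrder po₁ po₂ =
    isPartialOrder-on (splitAt k₁) (splitAt-injective k₁ ∘ Pointwise-≡⇒≡) (⊎-isPartialOrder po₁ po₂)

  ⊕-↑ˡ : ∀ {i i′} → R₁ i i′ → (R₁ ⊕ R₂) (i ↑ˡ k₂) (i′ ↑ˡ k₂)
  ⊕-↑ˡ {i} {i′} =
    subst₂ (Pointwise R₁ R₂) (sym (splitAt-↑ˡ k₁ i k₂)) (sym (splitAt-↑ˡ k₁ i′ k₂)) ∘ inj₁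

  ⊕-↑ʳ : ∀ {j j′} → R₂ j j′ → (R₁ ⊕ R₂) (k₁ ↑ʳ j) (k₁ ↑ʳ j′)
  ⊕-↑ʳ {j} {j′} =
    subst₂ (Pointwise R₁ R₂) (sym (splitAt-↑ʳ k₁ k₂ j)) (sym (splitAt-↑ʳ k₁ k₂ j′)) ∘ inj₂

  ++-downSet⁺ : {X₁ : Subset k₁} {X₂ : Subset k₂} →
                downSets R₁ X₁ → downSets R₂ X₂ → downSets (R₁ ⊕ R₂) (X₁ ++ X₂)
  ++-downSet⁺ {X₁} {X₂} down₁ down₂ e f e∈X f≤e = ∈-++⁺ X₁ (closed (∈-++⁻ X₁ e∈X) f≤e)
    where
    closed : ∀ {s t} → [ _∈ X₁ , _∈ X₂ ]′ s → Pointwise R₁ R₂ t s → [ _∈ X₁ , _∈ X₂ ]′ t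
    closed s∈X (inj₁ t≤s) = down₁ _ _ s∈X t≤s
    closed s∈X (inj₂ t≤s) = down₂ _ _ s∈X t≤s

  ++-downSet⁻ : (X₁ : Subset k₁) {X₂ : Subset k₂} →
                downSets (R₁ ⊕ R₂) (X₁ ++ X₂) → downSets R₁ X₁ × downSets R₂ X₂
  ++-downSet⁻ X₁ down =
      (λ i i′ i∈X₁ i′≤i → ∈-++⁻ˡ X₁ (down _ _ (∈-++⁺ˡ i∈X₁) (⊕-↑ˡ i′≤i)))
    , (λ j j′ j∈X₂ j′≤j → ∈-++⁻ʳ X₁ (down _ _ (∈-++⁺ʳ X₁ j∈X₂) (⊕-↑ʳ j′≤j)))

  downSets-⊕ : product (downSets R₁) (downSets R₂) ≐ downSets (R₁ ⊕ R₂)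
  downSets-⊕ = (λ { (_ , _ , down₁ , down₂ , refl) → ++-downSet⁺ down₁ down₂ }) , from _
    where
    from : ∀ Y → downSets (R₁ ⊕ R₂) Y → product (downSets R₁) (downSets R₂) Y
    from Y down with Vec.splitAt k₁ Y
    ... | X₁ , X₂ , refl = let down₁ , down₂ = ++-downSet⁻ X₁ down in X₁ , X₂ , down₁ , down₂ , refl

ReachIn-map : ∀ {m m′} {G : Fin (suc m) → Fin (suc m) → Set}
                {G′ : Fin (suc m′) → Fin (suc m′) → Set}
                {X : Subset m} {X′ : Subset m′} (h : Fin m → Fin m′) →
              (∀ {x} → G zero (suc x) → G′ zero (suc (h x))) →
              (∀ {x y} → G (suc x) (suc y) → G′ (suc (h x)) (suc (h y))) →
              (∀ {x} → x ∈ X → h x ∈ X′) →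
              ∀ {x} → ReachIn G X x → ReachIn G′ X′ (h x)
ReachIn-map h root arc mem (start x∈X r→x) = start (mem x∈X) (root r→x)
ReachIn-map h root arc mem (step path y∈X x→y) =
  step (ReachIn-map h root arc mem path) (mem y∈X) (arc x→y)

module _ (G₁ : Fin (suc m₁) → Fin (suc m₁) → Set) (G₂ : Fin (suc m₂) → Fin (suc m₂) → Set) where

  -- Arcs into a root never lie on a search path, so they are dropped.
  data Wedge : Fin (suc (m₁ + m₂)) → Fin (suc (m₁ + m₂)) → Set where
    root₁ : ∀ {i}    → G₁ zero (suc i)     → Wedge zero (suc (i ↑ˡ m₂))
    root₂ : ∀ {j}    → G₂ zero (suc j)     → Wedge zero (suc (m₁ ↑ʳ j))
    arc₁  : ∀ {i i′} → G₁ (suc i) (suc i′) → Wedge (suc (i ↑ˡ m₂)) (suc (i′ ↑ˡ m₂))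
    arc₂  : ∀ {j j′} → G₂ (suc j) (suc j′) → Wedge (suc (m₁ ↑ʳ j)) (suc (m₁ ↑ʳ j′))

  module _ {A₁ : Subset m₁} {A₂ : Subset m₂} where

    ReachIn-wedge⁻ˡ : ∀ {x i} → ReachIn Wedge (A₁ ++ A₂) x → x ≡ i ↑ˡ m₂ → ReachIn G₁ A₁ i
    ReachIn-wedge⁻ˡ (start x∈A (root₁ r→x)) eq with refl ← ↑ˡ-injective m₂ _ _ eq =
      start (∈-++⁻ˡ A₁ x∈A) r→x
    ReachIn-wedge⁻ˡ (step path y∈A (arc₁ x→y)) eq with refl ← ↑ˡ-injective m₂ _ _ eq =
      step (ReachIn-wedge⁻ˡ path refl) (∈-++⁻ˡ A₁ y∈A) x→y
    ReachIn-wedge⁻ˡ (start _ (root₂ _)) eq = ⊥-elim (↑ˡ≢↑ʳ _ _ (sym eq))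
    ReachIn-wedge⁻ˡ (step _ _ (arc₂ _)) eq = ⊥-elim (↑ˡ≢↑ʳ _ _ (sym eq))

    ReachIn-wedge⁻ʳ : ∀ {x j} → ReachIn Wedge (A₁ ++ A₂) x → x ≡ m₁ ↑ʳ j → ReachIn G₂ A₂ j
    ReachIn-wedge⁻ʳ (start x∈A (root₂ r→x)) eq with refl ← ↑ʳ-injective m₁ _ _ eq =
      start (∈-++⁻ʳ A₁ x∈A) r→x
    ReachIn-wedge⁻ʳ (step path y∈A (arc₂ x→y)) eq with refl ← ↑ʳ-injective m₁ _ _ eq =
      step (ReachIn-wedge⁻ʳ path refl) (∈-++⁻ʳ A₁ y∈A) x→y
    ReachIn-wedge⁻ʳ (start _ (root₁ _)) eq = ⊥-elim (↑ˡ≢↑ʳ _ _ eq)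
    ReachIn-wedge⁻ʳ (step _ _ (arc₁ _)) eq = ⊥-elim (↑ˡ≢↑ʳ _ _ eq)

    searchable-wedge : (∀ i → i ∈ A₁ → ReachIn G₁ A₁ i) → (∀ j → j ∈ A₂ → ReachIn G₂ A₂ j) →
                       ∀ x → x ∈ A₁ ++ A₂ → ReachIn Wedge (A₁ ++ A₂) x
    searchable-wedge reach₁ reach₂ x x∈A =
      subst (ReachIn Wedge (A₁ ++ A₂)) (join-splitAt m₁ m₂ x) (reach (splitAt m₁ x) (∈-++⁻ A₁ x∈A))
      where
      reach : ∀ s → [ _∈ A₁ , _∈ A₂ ]′ s → ReachIn Wedge (A₁ ++ A₂) (join m₁ m₂ s)
      reach (inj₁ i) i∈A₁ = ReachIn-map (_↑ˡ m₂) root₁ arc₁ ∈-++⁺ˡ (reach₁ i i∈A₁)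
      reach (inj₂ j) j∈A₂ = ReachIn-map (m₁ ↑ʳ_) root₂ arc₂ (∈-++⁺ʳ A₁) (reach₂ j j∈A₂)

  pointSearch-wedge : product (pointSearch G₁) (pointSearch G₂) ≐ pointSearch Wedge
  pointSearch-wedge = to , from _
    where
    to : ∀ {Y} → product (pointSearch G₁) (pointSearch G₂) Y → pointSearch Wedge Y
    to (_ , _ , (A₁ , reach₁ , refl) , (A₂ , reach₂ , refl) , refl) =
      A₁ ++ A₂ , searchable-wedge reach₁ reach₂ , sym (∁-++ A₁ A₂)

    from : ∀ Y → pointSearch Wedge Y → product (pointSearch G₁) (pointSearch G₂) Y
    from _ (A , reach , refl) with Vec.splitAt m₁ A
    ... | A₁ , A₂ , refl =
      ∁ A₁ , ∁ A₂
      , (A₁ , (λ i i∈A₁ → ReachIn-wedge⁻ˡ (reach _ (∈-++⁺ˡ i∈A₁)) refl) , refl)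
      , (A₂ , (λ j j∈A₂ → ReachIn-wedge⁻ʳ (reach _ (∈-++⁺ʳ A₁ j∈A₂)) refl) , refl)
      , ∁-++ A₁ A₂

mainTheorem9 : ∀ {n₁ n₂ : ℕ} (E₁ : Family n₁) (E₂ : Family n₂) →
    IsConvexGeometry n₁ E₁ → IsConvexGeometry n₂ E₂ →
    (IsPosetShelling n₁ E₁ → IsPosetShelling n₂ E₂ →
      IsPosetShelling (n₁ + n₂) (product E₁ E₂))
    × (IsDigraphPointSearch n₁ E₁ → IsDigraphPointSearch n₂ E₂ →
      IsDigraphPointSearch (n₁ + n₂) (product E₁ E₂))
mainTheorem9 E₁ E₂ _ _ =
    (λ { (k₁ , R₁ , po₁ , I₁) (k₂ , R₂ , po₂ , I₂) →
         k₁ + k₂ , R₁ ⊕ R₂ , ⊕-isPartialOrder po₁ po₂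
         , ≅-trans (product-cong I₁ I₂) (≐⇒≅ downSets-⊕) })
  , (λ { (m₁ , G₁ , I₁) (m₂ , G₂ , I₂) →
         m₁ + m₂ , Wedge G₁ G₂ , ≅-trans (product-cong I₁ I₂) (≐⇒≅ (pointSearch-wedge G₁ G₂)) })
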